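{- For each positive integer $n$ and each $b\in\mathrm{PF}_\le(n)$, \[\sum_{w\in\mathfrak S_n}t^{\mathrm{exced}(\pi^{b,w})}=\sum_{k\ge0}\mathrm{rook}_k(B_b)\,(n-k)!\,(t-1)^k.\]
   Context: A parking content is a sequence $b=(b_1,\dots,b_n)$ of positive integers with $b_1\le\dots\le b_n$ and $b_j\le j$ for all $j$; $\mathrm{PF}_\le(n)$ is the set of these. For $w\in\mathfrak S_n$, $\pi^{b,w}$ is the sequence with $\pi^{b,w}_i=b_{w(i)}$, and $\mathrm{exced}(\pi)=|\{i\in[n]:\pi_i>i\}|$. $B_b$ is the board of cells $(r,c)\in[n]\times[n]$ (row $r$, column $c$) with $r<b_c$. $\mathrm{rook}_k(B_b)$ is the number of ways to place $k$ nonattacking rooks (no two in the same row or column) on cells of $B_b$. -}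

module Defs where

open import Data.Nat using (ℕ; zero; suc; _!; _≤_; _<_; _∸_; _≟_; _≤?_; _<?_)

open import Data.Integer as ℤ using (ℤ; +_; _+_; _*_; _-_; _^_)
open import Data.Fin using (Fin; zero; suc; toℕ) renaming (_≟_ to _≟F_)
open import Data.Fin.Properties using (all?)
open import Data.Vec using (Vec; lookup)
open import Data.List using (List; []; _∷_; [_]; map; concatMap; filter; length; foldr; upTo)
open import Data.Bool using (Bool; true; false)
open import Data.Product using (_×_; _,_)
open import Relation.Binary.PropositionalEquality using (_≡_; _≢_)
open import Relation.Nullary using (Dec; ¬_)
open import Relation.Nullary.Decidable using (_×-dec_; _→-dec_; ¬?)
open import Data.Bool.Properties using () renaming (_≟_ to _≟B_)

allFns : ∀ {a} {A : Set a} (n : ℕ) → List A → List (Fin n → A)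
allFns zero    xs = [ (λ ()) ]
allFns (suc n) xs =
  concatMap (λ x → map (λ f → λ { zero → x ; (suc i) → f i }) (allFns n xs)) xs

allFin : (n : ℕ) → List (Fin n)
allFin zero    = []
allFin (suc n) = zero ∷ map suc (allFin n)

sumℤ : List ℤ → ℤ
sumℤ = foldr _+_ (+ 0)

-- Parking contents.  A sequence b = (b_1,…,b_n) is a Vec ℕ n; the
-- 1-based index j corresponds to (j' : Fin n) with j = toℕ j' + 1.

IsParkingContent : (n : ℕ) → Vec ℕ n → Set
IsParkingContent n b =
  ((j : Fin n) → 1 ≤ lookup b j)
  × ((i j : Fin n) → toℕ i ≤ toℕ j → lookup b i ≤ lookup b j)
  × ((j : Fin n) → lookup b j ≤ suc (toℕ j))

-- The symmetric group S_n: the bijections Fin n → Fin n, i.e. the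
-- injective maps Fin n → Fin n (injective endomaps of a finite set).

IsPerm : (n : ℕ) → (Fin n → Fin n) → Set
IsPerm n w = (i j : Fin n) → w i ≡ w j → i ≡ j

isPerm? : (n : ℕ) (w : Fin n → Fin n) → Dec (IsPerm n w)
isPerm? n w = all? λ i → all? λ j → (w i ≟F w j) →-dec (i ≟F j)

Sym : (n : ℕ) → List (Fin n → Fin n)
Sym n = filter (isPerm? n) (allFns n (allFin n))

πbw : {n : ℕ} → Vec ℕ n → (Fin n → Fin n) → Fin n → ℕ
πbw b w i = lookup b (w i)

exced : (n : ℕ) → (Fin n → ℕ) → ℕ
exced n π = length (filter (λ i → suc (toℕ i) <? π i) (allFin n))

InBoard : {n : ℕ} → Vec ℕ n → Fin n → Fin n → Set
InBoard b r c = suc (toℕ r) < lookup b c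

-- A placement of rooks is a set of cells, given by its indicator
-- S : Fin n → Fin n → Bool  (S r c = true iff a rook is on (r,c)).

Occ : {n : ℕ} → (Fin n → Fin n → Bool) → Fin n → Fin n → Set
Occ S r c = S r c ≡ true

numCells : (n : ℕ) → (Fin n → Fin n → Bool) → ℕ
numCells n S =
  length (filter (λ r → S (Data.Product.proj₁ r) (Data.Product.proj₂ r) ≟B true)
                 (concatMap (λ r → map (λ c → r , c) (allFin n)) (allFin n)))

NonAttackingOn : (n : ℕ) → Vec ℕ n → (Fin n → Fin n → Bool) → Set
NonAttackingOn n b S =
  ((r c : Fin n) → Occ S r c → InBoard b r c)
  × ((r c r' c' : Fin n) → Occ S r c → Occ S r' c' →
       (r ≡ r' → c ≡ c') × (c ≡ c' → r ≡ r'))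

nonAttackingOn? : (n : ℕ) (b : Vec ℕ n) (S : Fin n → Fin n → Bool) → Dec (NonAttackingOn n b S)
nonAttackingOn? n b S =
  (all? λ r → all? λ c → (S r c ≟B true) →-dec (suc (toℕ r) <? lookup b c))
  ×-dec
  (all? λ r → all? λ c → all? λ r' → all? λ c' →
     (S r c ≟B true) →-dec ((S r' c' ≟B true) →-dec
       (((r ≟F r') →-dec (c ≟F c')) ×-dec ((c ≟F c') →-dec (r ≟F r')))))

rook : (n : ℕ) → Vec ℕ n → ℕ → ℕ
rook n b k =
  length (filter (λ S → nonAttackingOn? n b S ×-dec (numCells n S ≟ k))
                 (allFns n (allFns n (true ∷ false ∷ []))))

lhs : (n : ℕ) → Vec ℕ n → ℤ → ℤ
lhs n b t = sumℤ (map (λ w → t ^ exced n (πbw b w)) (Sym n))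

-- Σ_{k ≥ 0} rook_k(B_b) (n-k)! (t-1)^k ; rook_k(B_b) = 0 for k > n,
-- so the sum is over k = 0,…,n.
rhs : (n : ℕ) → Vec ℕ n → ℤ → ℤ
rhs n b t = sumℤ (map (λ k → (+ rook n b k) * (+ ((n ∸ k) !)) * ((t - + 1) ^ k))
                      (upTo (suc n)))

-- Put x = t - 1. As exced(π^{b,w}) counts the rows r with (r, w r) ∈ B_b,
--   t ^ exced(π^{b,w}) = ∏_{r,c} (1 + x [w r = c] [(r,c) ∈ B_b]) = ∑_S x^|S| [S ⊆ graph w] [S ⊆ B_b],
-- the sum running over all sets S of cells. Summing over w first, the coefficient of x^|S| is
-- [S ⊆ B_b] times the number of permutations whose graph contains S. This number is 0 unless S
-- is non-attacking, and then it is (n - |S|)!: an empty row of S can be filled by a rook in any of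
-- the n - |S| empty columns, and each choice is again non-attacking with one more rook.
-- Grouping the sets S by k = |S| gives rook_k(B_b) (n - k)! (t - 1)^k.

module Submission where

open import Algebra.Bundles using (CommutativeMonoid; CommutativeSemiring)
open import Data.Bool using (Bool; true; false; if_then_else_; _∧_; _∨_)
open import Data.Bool.Properties using (¬-not; not-¬; ∨-zeroʳ; ∨-identityʳ) renaming (_≟_ to _≟B_)
open import Data.Fin using (Fin; zero; suc; toℕ) renaming (_≟_ to _≟F_)
open import Data.Fin.Properties using (all?; any?; ∀-cons-⇔; ¬∀⟶∃¬)
open import Data.List using (List; []; _∷_; map; concatMap; filter; foldr; length; _++_; upTo; applyUpTo)
open import Data.List.Properties using (map-upTo)
open import Data.Product using (_×_; _,_; proj₁; proj₂; ∃; swap)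
open import Data.Empty using (⊥-elim)
open import Data.Vec using (Vec; lookup)
open import Data.Sum using (_⊎_; inj₁; inj₂; [_,_]′)
open import Data.Nat as Nat using (ℕ; zero; suc; _∸_; _!; _≤_; _<?_; z≤n; s≤s) renaming (_≟_ to _≟ℕ_)
import Data.Nat.Properties as ℕP
open import Data.Integer as Int using (ℤ; +_)
import Data.Integer.Properties as ℤP
open import Function using (_∘_; flip; case_of_; _⇔_; mk⇔)
open import Relation.Nullary using (Dec; yes; no; does; ¬_)
open import Relation.Nullary.Decidable using (_×-dec_; _→-dec_; does-⇔; dec-true; dec-false)
open import Relation.Unary using (Pred; Decidable)
open import Relation.Binary.PropositionalEquality
  using (_≡_; _≢_; refl; sym; trans; cong; cong₂; subst; module ≡-Reasoning)

open import Defs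

module ListFold {c ℓ} (M : CommutativeMonoid c ℓ) where
  open CommutativeMonoid M
    renaming (Carrier to A; refl to ≈-refl; sym to ≈-sym; trans to ≈-trans)
  open import Algebra.Properties.CommutativeSemigroup commutativeSemigroup using (interchange)
  open import Relation.Binary.Reasoning.Setoid setoid

  fold : {X : Set} → List X → (X → A) → A
  fold xs f = foldr _∙_ ε (map f xs)

  private variable X Y : Set

  fold-cong : (xs : List X) {f g : X → A} → (∀ x → f x ≈ g x) → fold xs f ≈ fold xs g
  fold-cong []       f≈g = ≈-refl
  fold-cong (x ∷ xs) f≈g = ∙-cong (f≈g x) (fold-cong xs f≈g)

  fold-++ : (xs ys : List X) (f : X → A) → fold (xs ++ ys) f ≈ fold xs f ∙ fold ys f
  fold-++ []       ys f = ≈-sym (identityˡ _)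
  fold-++ (x ∷ xs) ys f = begin
    f x ∙ fold (xs ++ ys) f        ≈⟨ ∙-congˡ (fold-++ xs ys f) ⟩
    f x ∙ (fold xs f ∙ fold ys f)  ≈⟨ assoc _ _ _ ⟨
    (f x ∙ fold xs f) ∙ fold ys f  ∎

  fold-map : (h : X → Y) (xs : List X) (f : Y → A) → fold (map h xs) f ≈ fold xs (f ∘ h)
  fold-map h []       f = ≈-refl
  fold-map h (x ∷ xs) f = ∙-congˡ (fold-map h xs f)

  fold-concatMap : (h : X → List Y) (xs : List X) (f : Y → A) →
                   fold (concatMap h xs) f ≈ fold xs (λ x → fold (h x) f)
  fold-concatMap h []       f = ≈-refl
  fold-concatMap h (x ∷ xs) f = begin
    fold (h x ++ concatMap h xs) f               ≈⟨ fold-++ (h x) _ f ⟩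
    fold (h x) f ∙ fold (concatMap h xs) f       ≈⟨ ∙-congˡ (fold-concatMap h xs f) ⟩
    fold (h x) f ∙ fold xs (λ x → fold (h x) f)  ∎

  fold-ε : (xs : List X) → fold xs (λ _ → ε) ≈ ε
  fold-ε []       = ≈-refl
  fold-ε (x ∷ xs) = ≈-trans (identityˡ _) (fold-ε xs)

  fold-∙ : (xs : List X) (f g : X → A) → fold xs (λ x → f x ∙ g x) ≈ fold xs f ∙ fold xs g
  fold-∙ []       f g = ≈-sym (identityˡ ε)
  fold-∙ (x ∷ xs) f g = ≈-trans (∙-congˡ (fold-∙ xs f g)) (interchange _ _ _ _)

  fold-comm : (xs : List X) (ys : List Y) (f : X → Y → A) →
              fold xs (λ x → fold ys (f x)) ≈ fold ys (λ y → fold xs (λ x → f x y))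
  fold-comm []       ys f = ≈-sym (fold-ε ys)
  fold-comm (x ∷ xs) ys f = begin
    fold ys (f x) ∙ fold xs (λ x → fold ys (f x))            ≈⟨ ∙-congˡ (fold-comm xs ys f) ⟩
    fold ys (f x) ∙ fold ys (λ y → fold xs (λ x → f x y))    ≈⟨ fold-∙ ys (f x) _ ⟨
    fold ys (λ y → f x y ∙ fold xs (λ x → f x y))            ∎

  fold-δ : ∀ {n} (a : Fin n) (f : Fin n → A) →
           fold (allFin n) (λ i → if does (a ≟F i) then f i else ε) ≈ f a
  fold-δ {suc n} zero    f = begin
    f zero ∙ fold (map suc (allFin n)) _   ≈⟨ ∙-congˡ (fold-map suc (allFin n) _) ⟩
    f zero ∙ fold (allFin n) (λ _ → ε)     ≈⟨ ∙-congˡ (fold-ε (allFin n)) ⟩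
    f zero ∙ ε                             ≈⟨ identityʳ _ ⟩
    f zero                                 ∎
  fold-δ {suc n} (suc a) f = begin
    ε ∙ fold (map suc (allFin n)) δ                                 ≈⟨ identityˡ _ ⟩
    fold (map suc (allFin n)) δ                                     ≈⟨ fold-map suc (allFin n) δ ⟩
    fold (allFin n) (λ i → if does (a ≟F i) then f (suc i) else ε)  ≈⟨ fold-δ a (f ∘ suc) ⟩
    f (suc a)                                                       ∎
    where
    δ : Fin (suc n) → A
    δ i = if does (suc a ≟F i) then f i else ε

module BigOperators {c ℓ} (R : CommutativeSemiring c ℓ) where
  open CommutativeSemiring R hiding (zero)
    renaming (Carrier to A; refl to ≈-refl; reflexive to ≈-reflexive; sym to ≈-sym; trans to ≈-trans)
  open import Relation.Binary.Reasoning.Setoid setoid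

  open ListFold +-commutativeMonoid public using () renaming
    ( fold to ∑; fold-cong to ∑-cong; fold-map to ∑-map; fold-concatMap to ∑-concatMap
    ; fold-ε to ∑-zero; fold-∙ to ∑-+; fold-comm to ∑-comm; fold-δ to ∑-δ )
  open ListFold *-commutativeMonoid public using () renaming
    ( fold to ∏; fold-cong to ∏-cong; fold-map to ∏-map; fold-ε to ∏-one; fold-∙ to ∏-*
    ; fold-δ to ∏-δ )

  private variable X : Set

  ⟦_⟧ : Bool → A
  ⟦ b ⟧ = if b then 1# else 0#

  ⟦∧⟧ : ∀ a b → ⟦ a ∧ b ⟧ ≈ ⟦ a ⟧ * ⟦ b ⟧
  ⟦∧⟧ true  b = ≈-sym (*-identityˡ _)
  ⟦∧⟧ false b = ≈-sym (zeroˡ _)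

  *-distribˡ-∑ : ∀ a (xs : List X) f → a * ∑ xs f ≈ ∑ xs (λ x → a * f x)
  *-distribˡ-∑ a []       f = zeroʳ a
  *-distribˡ-∑ a (x ∷ xs) f = ≈-trans (distribˡ a _ _) (+-congˡ (*-distribˡ-∑ a xs f))

  *-distribʳ-∑ : ∀ a (xs : List X) f → ∑ xs f * a ≈ ∑ xs (λ x → f x * a)
  *-distribʳ-∑ a xs f = begin
    ∑ xs f * a               ≈⟨ *-comm _ a ⟩
    a * ∑ xs f               ≈⟨ *-distribˡ-∑ a xs f ⟩
    ∑ xs (λ x → a * f x)     ≈⟨ ∑-cong xs (λ x → *-comm a (f x)) ⟩
    ∑ xs (λ x → f x * a)     ∎

  ∑-filter : ∀ {p} {P : Pred X p} (P? : Decidable P) xs f →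
             ∑ (filter P? xs) f ≈ ∑ xs (λ x → ⟦ does (P? x) ⟧ * f x)
  ∑-filter P? []       f = ≈-refl
  ∑-filter P? (x ∷ xs) f with does (P? x)
  ... | true  = +-cong (≈-sym (*-identityˡ _)) (∑-filter P? xs f)
  ... | false = begin
    ∑ (filter P? xs) f                                   ≈⟨ ∑-filter P? xs f ⟩
    ∑ xs (λ x → ⟦ does (P? x) ⟧ * f x)                   ≈⟨ +-identityˡ _ ⟨
    0# + ∑ xs (λ x → ⟦ does (P? x) ⟧ * f x)              ≈⟨ +-congʳ (zeroˡ (f x)) ⟨
    0# * f x + ∑ xs (λ x → ⟦ does (P? x) ⟧ * f x)        ∎

  ∏-⟦⟧ : ∀ {n p} {P : Pred (Fin n) p} (P? : Decidable P) →
         ∏ (allFin n) (λ i → ⟦ does (P? i) ⟧) ≈ ⟦ does (all? P?) ⟧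
  ∏-⟦⟧ {zero}  P? = ≈-reflexive (cong ⟦_⟧ (sym (dec-true (all? P?) (λ ()))))
  ∏-⟦⟧ {suc n} P? = begin
    ⟦ does (P? zero) ⟧ * ∏ (map suc (allFin n)) (λ i → ⟦ does (P? i) ⟧)
      ≈⟨ *-congˡ (∏-map suc (allFin n) _) ⟩
    ⟦ does (P? zero) ⟧ * ∏ (allFin n) (λ i → ⟦ does (P? (suc i)) ⟧)
      ≈⟨ *-congˡ (∏-⟦⟧ (P? ∘ suc)) ⟩
    ⟦ does (P? zero) ⟧ * ⟦ does (all? (P? ∘ suc)) ⟧
      ≈⟨ ⟦∧⟧ _ _ ⟨
    ⟦ does (P? zero ×-dec all? (P? ∘ suc)) ⟧
      ≡⟨ cong ⟦_⟧ (does-⇔ ∀-cons-⇔ (P? zero ×-dec all? (P? ∘ suc)) (all? P?)) ⟩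
    ⟦ does (all? P?) ⟧ ∎

  ∏-distrib-∑ : ∀ n (xs : List X) (g : Fin n → X → A) →
                ∏ (allFin n) (λ i → ∑ xs (g i))
                ≈ ∑ (allFns n xs) (λ f → ∏ (allFin n) (λ i → g i (f i)))
  ∏-distrib-∑ zero    xs g = ≈-sym (+-identityʳ 1#)
  ∏-distrib-∑ (suc n) xs g = begin
    ∑ xs (g zero) * ∏ (map suc (allFin n)) (λ i → ∑ xs (g i))
      ≈⟨ *-congˡ (≈-trans (∏-map suc (allFin n) _) (∏-distrib-∑ n xs (g ∘ suc))) ⟩
    ∑ xs (g zero) * ∑ (allFns n xs) (λ f → ∏ (allFin n) (λ i → g (suc i) (f i)))
      ≈⟨ *-distribʳ-∑ _ xs (g zero) ⟩
    ∑ xs (λ x → g zero x * ∑ (allFns n xs) (λ f → ∏ (allFin n) (λ i → g (suc i) (f i))))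
      ≈⟨ ∑-cong xs (λ x → *-distribˡ-∑ (g zero x) (allFns n xs) _) ⟩
    ∑ xs (λ x → ∑ (allFns n xs) (λ f → g zero x * ∏ (allFin n) (λ i → g (suc i) (f i))))
      ≈⟨ ≈-sym (
        ≈-trans (∑-concatMap _ xs _) (∑-cong xs λ x →
          ≈-trans (∑-map _ (allFns n xs) _) (∑-cong (allFns n xs) λ f →
            *-congˡ (∏-map suc (allFin n) _)))) ⟩
    ∑ (allFns (suc n) xs) (λ f → ∏ (allFin (suc n)) (λ i → g i (f i))) ∎

  ∏-1+ : ∀ n (g : Fin n → A) →
         ∏ (allFin n) (λ i → 1# + g i)
         ≈ ∑ (allFns n (true ∷ false ∷ [])) (λ s → ∏ (allFin n) (λ i → if s i then g i else 1#))
  ∏-1+ n g = ≈-trans (∏-cong (allFin n) λ i → ≈-trans (+-comm 1# (g i)) (+-congˡ (≈-sym (+-identityʳ 1#))))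
                     (∏-distrib-∑ n (true ∷ false ∷ []) (λ i s → if s then g i else 1#))

  ∏∏-1+ : ∀ m n (g : Fin m → Fin n → A) →
          ∏ (allFin m) (λ i → ∏ (allFin n) (λ j → 1# + g i j))
          ≈ ∑ (allFns m (allFns n (true ∷ false ∷ [])))
              (λ S → ∏ (allFin m) (λ i → ∏ (allFin n) (λ j → if S i j then g i j else 1#)))
  ∏∏-1+ m n g = ≈-trans (∏-cong (allFin m) (λ i → ∏-1+ n (g i)))
                        (∏-distrib-∑ m (allFns n (true ∷ false ∷ []))
                                     (λ i s → ∏ (allFin n) (λ j → if s j then g i j else 1#)))

  ∑-upTo-suc : ∀ n (h : ℕ → A) → ∑ (upTo (suc n)) h ≈ h 0 + ∑ (upTo n) (h ∘ suc)
  ∑-upTo-suc n h = begin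
    h 0 + ∑ (applyUpTo suc n) h       ≡⟨ cong (λ ks → h 0 + ∑ ks h) (map-upTo suc n) ⟨
    h 0 + ∑ (map suc (upTo n)) h      ≈⟨ +-congˡ (∑-map suc (upTo n) h) ⟩
    h 0 + ∑ (upTo n) (h ∘ suc)        ∎

  ∑-upTo-δ : ∀ {m n} → m ≤ n → (f : ℕ → A) →
             ∑ (upTo (suc n)) (λ k → ⟦ does (m ≟ℕ k) ⟧ * f k) ≈ f m
  ∑-upTo-δ {n = n} z≤n f = begin
    ∑ (upTo (suc n)) (λ k → ⟦ does (0 ≟ℕ k) ⟧ * f k)
      ≈⟨ ∑-upTo-suc n _ ⟩
    1# * f 0 + ∑ (upTo n) (λ k → 0# * f (suc k))
      ≈⟨ +-cong (*-identityˡ _) (≈-trans (∑-cong (upTo n) (λ k → zeroˡ _)) (∑-zero (upTo n))) ⟩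
    f 0 + 0#
      ≈⟨ +-identityʳ _ ⟩
    f 0 ∎
  ∑-upTo-δ {suc m} {suc n} (s≤s m≤n) f = begin
    ∑ (upTo (suc (suc n))) (λ k → ⟦ does (suc m ≟ℕ k) ⟧ * f k)
      ≈⟨ ∑-upTo-suc (suc n) _ ⟩
    0# * f 0 + ∑ (upTo (suc n)) (λ k → ⟦ does (m ≟ℕ k) ⟧ * f (suc k))
      ≈⟨ +-cong (zeroˡ _) (∑-upTo-δ m≤n (f ∘ suc)) ⟩
    0# + f (suc m)
      ≈⟨ +-identityˡ _ ⟩
    f (suc m) ∎

module ℕ∑ = BigOperators ℕP.+-*-commutativeSemiring
module ℤ∑ = BigOperators ℤP.+-*-commutativeSemiring

module _ where
  open Nat using (_+_; _*_)
  open ℕ∑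
  open ≡-Reasoning

  length-filter≡∑⟦⟧ : ∀ {X : Set} {p} {P : Pred X p} (P? : Decidable P) xs →
                      length (filter P? xs) ≡ ∑ xs (λ x → ⟦ does (P? x) ⟧)
  length-filter≡∑⟦⟧ P? []       = refl
  length-filter≡∑⟦⟧ P? (x ∷ xs) with does (P? x)
  ... | true  = cong suc (length-filter≡∑⟦⟧ P? xs)
  ... | false = length-filter≡∑⟦⟧ P? xs

  ∑-allFin-1 : ∀ n → ∑ (allFin n) (λ _ → 1) ≡ n
  ∑-allFin-1 zero    = refl
  ∑-allFin-1 (suc n) = cong suc (trans (∑-map suc (allFin n) _) (∑-allFin-1 n))

  ∑-allFin≡0 : ∀ {n} (f : Fin n → ℕ) → ∑ (allFin n) f ≡ 0 → ∀ i → f i ≡ 0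
  ∑-allFin≡0 {suc n} f ∑≡0 zero    = ℕP.m+n≡0⇒m≡0 (f zero) ∑≡0
  ∑-allFin≡0 {suc n} f ∑≡0 (suc i) =
    ∑-allFin≡0 (f ∘ suc) (trans (sym (∑-map suc (allFin n) f)) (ℕP.m+n≡0⇒n≡0 (f zero) ∑≡0)) i

CellSet : ℕ → Set
CellSet n = Fin n → Fin n → Bool

allCellSets : ∀ n → List (CellSet n)
allCellSets n = allFns n (allFns n (true ∷ false ∷ []))

module _ {n : ℕ} where
  open Nat using (_+_; _*_)
  open ℕ∑
  open ≡-Reasoning

  _⊆_ : CellSet n → (Fin n → Fin n → Set) → Set
  S ⊆ A = ∀ r c → Occ S r c → A r c

  _⊆?_ : ∀ {A : Fin n → Fin n → Set} (S : CellSet n) → (∀ r c → Dec (A r c)) → Dec (S ⊆ A)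
  S ⊆? A? = all? λ r → all? λ c → (S r c ≟B true) →-dec A? r c

  ⊆-×-⇔ : ∀ {S A B} → S ⊆ (λ r c → A r c × B r c) ⇔ (S ⊆ A × S ⊆ B)
  ⊆-×-⇔ = mk⇔ (λ sub → (λ r c → proj₁ ∘ sub r c) , (λ r c → proj₂ ∘ sub r c))
              (λ { (subA , subB) r c o → subA r c o , subB r c o })

  Graph : (Fin n → Fin n) → Fin n → Fin n → Set
  Graph w r c = w r ≡ c

  graph? : (w : Fin n → Fin n) → ∀ r c → Dec (Graph w r c)
  graph? w r c = w r ≟F c

  -- NonAttackingOn n b S of Defs unfolds to S ⊆ InBoard b × NonAttacking S.
  NonAttacking : CellSet n → Set
  NonAttacking S =
    ∀ r c r′ c′ → Occ S r c → Occ S r′ c′ → (r ≡ r′ → c ≡ c′) × (c ≡ c′ → r ≡ r′)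

  EmptyRow : CellSet n → Fin n → Set
  EmptyRow S r = ∀ c → S r c ≡ false

  emptyRow? : ∀ S r → Dec (EmptyRow S r)
  emptyRow? S r = all? λ c → S r c ≟B false

  #emptyRows : CellSet n → ℕ
  #emptyRows S = ∑ (allFin n) (λ r → ⟦ does (emptyRow? S r) ⟧)

  #extensions : CellSet n → ℕ
  #extensions S = ∑ (Sym n) (λ w → ⟦ does (S ⊆? graph? w) ⟧)

  addRook : CellSet n → Fin n → Fin n → CellSet n
  addRook S r c i j = S i j ∨ (does (r ≟F i) ∧ does (c ≟F j))

  numCells≡∑∑ : ∀ S → numCells n S ≡ ∑ (allFin n) (λ r → ∑ (allFin n) (λ c → ⟦ S r c ⟧))
  numCells≡∑∑ S =
    trans (length-filter≡∑⟦⟧ _ (concatMap (λ r → map (r ,_) (allFin n)) (allFin n)))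
    (trans (∑-concatMap (λ r → map (r ,_) (allFin n)) (allFin n) occupied)
    (∑-cong (allFin n) λ r → trans (∑-map (r ,_) (allFin n) occupied)
                                   (∑-cong (allFin n) λ c → cong ⟦_⟧ (does-≟true (S r c)))))
    where
    occupied : Fin n × Fin n → ℕ
    occupied (r , c) = ⟦ does (S r c ≟B true) ⟧
    does-≟true : ∀ b → does (b ≟B true) ≡ b
    does-≟true true  = refl
    does-≟true false = refl

  numCells-flip : ∀ S → numCells n (flip S) ≡ numCells n S
  numCells-flip S = begin
    numCells n (flip S)                                  ≡⟨ numCells≡∑∑ (flip S) ⟩
    ∑ (allFin n) (λ c → ∑ (allFin n) (λ r → ⟦ S r c ⟧))  ≡⟨ ∑-comm (allFin n) (allFin n) _ ⟩
    ∑ (allFin n) (λ r → ∑ (allFin n) (λ c → ⟦ S r c ⟧))  ≡⟨ numCells≡∑∑ S ⟨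
    numCells n S                                         ∎

  nonAttacking-flip : ∀ {S} → NonAttacking S → NonAttacking (flip S)
  nonAttacking-flip na r c r′ c′ o o′ = swap (na c r c′ r′ o o′)

  rook-in-row : ∀ S r → ¬ EmptyRow S r → ∃ λ c → Occ S r c
  rook-in-row S r nonempty with ¬∀⟶∃¬ n (λ c → S r c ≡ false) (λ c → S r c ≟B false) nonempty
  ... | c , S≢false = c , ¬-not S≢false

  -- Stated for any decision of EmptyRow S r, since does (emptyRow? S r) unfolds and cannot be
  -- abstracted by a with-clause; the same device is used below.
  rowCells+emptyRow≡1 : ∀ {S} → NonAttacking S → ∀ r (empty? : Dec (EmptyRow S r)) →
                        ∑ (allFin n) (λ c → ⟦ S r c ⟧) + ⟦ does empty? ⟧ ≡ 1
  rowCells+emptyRow≡1 {S} na r (yes empty) =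
    cong (_+ 1) (trans (∑-cong (allFin n) (λ c → cong ⟦_⟧ (empty c))) (∑-zero (allFin n)))
  rowCells+emptyRow≡1 {S} na r (no nonempty) with rook-in-row S r nonempty
  ... | c₀ , occ₀ =
    trans (ℕP.+-identityʳ _) (trans (∑-cong (allFin n) (cong ⟦_⟧ ∘ row≡δ)) (∑-δ c₀ (λ _ → 1)))
    where
    row≡δ : ∀ c → S r c ≡ does (c₀ ≟F c)
    row≡δ c with c₀ ≟F c
    ... | yes refl = occ₀
    ... | no c₀≢c with S r c in occ
    ...   | true  = ⊥-elim (c₀≢c (proj₁ (na r c₀ r c occ₀ occ) refl))
    ...   | false = refl

  numCells+#emptyRows : ∀ {S} → NonAttacking S → numCells n S + #emptyRows S ≡ n
  numCells+#emptyRows {S} na = begin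
    numCells n S + #emptyRows S
      ≡⟨ cong (_+ #emptyRows S) (numCells≡∑∑ S) ⟩
    ∑ (allFin n) (λ r → ∑ (allFin n) (λ c → ⟦ S r c ⟧)) + #emptyRows S
      ≡⟨ ∑-+ (allFin n) _ _ ⟨
    ∑ (allFin n) (λ r → ∑ (allFin n) (λ c → ⟦ S r c ⟧) + ⟦ does (emptyRow? S r) ⟧)
      ≡⟨ ∑-cong (allFin n) (λ r → rowCells+emptyRow≡1 na r (emptyRow? S r)) ⟩
    ∑ (allFin n) (λ _ → 1)
      ≡⟨ ∑-allFin-1 n ⟩
    n ∎

  numCells+f≡n⇒#emptyRows≡f : ∀ {S f} → NonAttacking S → numCells n S + f ≡ n → #emptyRows S ≡ f
  numCells+f≡n⇒#emptyRows≡f {S} na eq =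
    ℕP.+-cancelˡ-≡ (numCells n S) _ _ (trans (numCells+#emptyRows na) (sym eq))

  #emptyRows≡0⇒noEmptyRow : ∀ {S} → #emptyRows S ≡ 0 → ∀ r → ¬ EmptyRow S r
  #emptyRows≡0⇒noEmptyRow {S} none r empty =
    ℕP.1+n≢0 (trans (cong ⟦_⟧ (sym (dec-true (emptyRow? S r) empty))) (∑-allFin≡0 _ none r))

  #emptyRows≢0⇒emptyRow : ∀ {S} → #emptyRows S ≢ 0 → ∃ (EmptyRow S)
  #emptyRows≢0⇒emptyRow {S} some with any? (emptyRow? S)
  ... | yes found = found
  ... | no none   = ⊥-elim (some (trans (∑-cong (allFin n) λ r → cong ⟦_⟧ (dec-false (emptyRow? S r) (none ∘ (r ,_))))
                                        (∑-zero (allFin n))))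

  numCells≤n : ∀ {S} → NonAttacking S → numCells n S ≤ n
  numCells≤n {S} na = subst (numCells n S ≤_) (numCells+#emptyRows na) (ℕP.m≤m+n _ _)

  addRook-new : ∀ S r c → Occ (addRook S r c) r c
  addRook-new S r c =
    trans (cong₂ (λ x y → S r c ∨ (x ∧ y)) (dec-true (r ≟F r) refl) (dec-true (c ≟F c) refl))
          (∨-zeroʳ (S r c))

  addRook-old : ∀ S r c {i j} → Occ S i j → Occ (addRook S r c) i j
  addRook-old S r c o = cong (_∨ _) o

  addRook-cases : ∀ S r c {i j} → Occ (addRook S r c) i j → Occ S i j ⊎ (r ≡ i × c ≡ j)
  addRook-cases S r c {i} {j} o with S i j | r ≟F i | c ≟F j
  ... | true  | _        | _        = inj₁ refl
  ... | false | yes r≡i  | yes c≡j  = inj₂ (r≡i , c≡j)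
  ... | false | yes _    | no _     = case o of λ ()
  ... | false | no _     | _        = case o of λ ()

  ⟦addRook⟧ : ∀ {S r c} → S r c ≡ false → ∀ i j →
              ⟦ addRook S r c i j ⟧ ≡ ⟦ S i j ⟧ + ⟦ does (r ≟F i) ⟧ * ⟦ does (c ≟F j) ⟧
  ⟦addRook⟧ {S} {r} {c} free i j with r ≟F i | c ≟F j
  ... | yes refl | yes refl rewrite free = refl
  ... | yes _    | no _     = trans (cong ⟦_⟧ (∨-identityʳ (S i j))) (sym (ℕP.+-identityʳ _))
  ... | no _     | _        = trans (cong ⟦_⟧ (∨-identityʳ (S i j))) (sym (ℕP.+-identityʳ _))

  numCells-addRook : ∀ {S r c} → S r c ≡ false → numCells n (addRook S r c) ≡ suc (numCells n S)
  numCells-addRook {S} {r} {c} free = begin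
    numCells n (addRook S r c)
      ≡⟨ numCells≡∑∑ (addRook S r c) ⟩
    ∑ (allFin n) (λ i → ∑ (allFin n) (λ j → ⟦ addRook S r c i j ⟧))
      ≡⟨ ∑-cong (allFin n) (λ i → trans (∑-cong (allFin n) (⟦addRook⟧ {S} free i))
                                        (∑-+ (allFin n) _ _)) ⟩
    ∑ (allFin n) (λ i → ∑ (allFin n) (λ j → ⟦ S i j ⟧) + ∑ (allFin n) (new i))
      ≡⟨ ∑-+ (allFin n) _ _ ⟩
    ∑ (allFin n) (λ i → ∑ (allFin n) (λ j → ⟦ S i j ⟧)) + ∑ (allFin n) (λ i → ∑ (allFin n) (new i))
      ≡⟨ cong₂ _+_ (sym (numCells≡∑∑ S)) ∑∑-new ⟩
    numCells n S + 1
      ≡⟨ ℕP.+-comm _ 1 ⟩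
    suc (numCells n S) ∎
    where
    new : Fin n → Fin n → ℕ
    new i j = ⟦ does (r ≟F i) ⟧ * ⟦ does (c ≟F j) ⟧
    ∑-new : ∀ i → ∑ (allFin n) (new i) ≡ ⟦ does (r ≟F i) ⟧
    ∑-new i = begin
      ∑ (allFin n) (new i)
        ≡⟨ *-distribˡ-∑ ⟦ does (r ≟F i) ⟧ (allFin n) _ ⟨
      ⟦ does (r ≟F i) ⟧ * ∑ (allFin n) (λ j → ⟦ does (c ≟F j) ⟧)
        ≡⟨ cong (⟦ does (r ≟F i) ⟧ *_) (∑-δ c (λ _ → 1)) ⟩
      ⟦ does (r ≟F i) ⟧ * 1
        ≡⟨ ℕP.*-identityʳ _ ⟩
      ⟦ does (r ≟F i) ⟧ ∎
    ∑∑-new : ∑ (allFin n) (λ i → ∑ (allFin n) (new i)) ≡ 1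
    ∑∑-new = trans (∑-cong (allFin n) ∑-new) (∑-δ r (λ _ → 1))

  addRook-nonAttacking : ∀ {S r c} → NonAttacking S → EmptyRow S r → EmptyRow (flip S) c →
                         NonAttacking (addRook S r c)
  addRook-nonAttacking {S} {r} {c} na emptyR emptyC i j i′ j′ o o′
    with addRook-cases S r c o | addRook-cases S r c o′
  ... | inj₁ a             | inj₁ a′             = na i j i′ j′ a a′
  ... | inj₁ a             | inj₂ (refl , refl)  =
    (λ { refl → ⊥-elim (not-¬ a (emptyR j)) }) , (λ { refl → ⊥-elim (not-¬ a (emptyC i)) })
  ... | inj₂ (refl , refl) | inj₁ a′             =
    (λ { refl → ⊥-elim (not-¬ a′ (emptyR j′)) }) , (λ { refl → ⊥-elim (not-¬ a′ (emptyC i′)) })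
  ... | inj₂ (refl , refl) | inj₂ (refl , refl)  = (λ _ → refl) , (λ _ → refl)

  addRook-attacking : ∀ {S r c i} → EmptyRow S r → Occ S i c → ¬ NonAttacking (addRook S r c)
  addRook-attacking {S} {r} {c} {i} emptyR o na = not-¬ o (subst (λ k → S k c ≡ false) r≡i (emptyR c))
    where
    r≡i : r ≡ i
    r≡i = proj₂ (na r c i c (addRook-new S r c) (addRook-old S r c o)) refl

  ⊆-graph⇒nonAttacking : ∀ {S w} → IsPerm n w → S ⊆ Graph w → NonAttacking S
  ⊆-graph⇒nonAttacking perm S⊆w r c r′ c′ o o′ =
    (λ { refl → trans (sym (S⊆w r c o)) (S⊆w r c′ o′) }) ,
    (λ c≡c′ → perm r r′ (trans (S⊆w r c o) (trans c≡c′ (sym (S⊆w r′ c′ o′)))))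

  addRook-⊆-graph : ∀ {S r c w} → addRook S r c ⊆ Graph w ⇔ (Graph w r c × S ⊆ Graph w)
  addRook-⊆-graph {S} {r} {c} {w} = mk⇔
    (λ sub → sub r c (addRook-new S r c) , λ i j o → sub i j (addRook-old S r c o))
    (λ { (wr≡c , sub) i j o → [ sub i j , (λ { (refl , refl) → wr≡c }) ]′ (addRook-cases S r c o) })

  #extensions-addRook : ∀ S r → #extensions S ≡ ∑ (allFin n) (λ c → #extensions (addRook S r c))
  #extensions-addRook S r = sym (begin
    ∑ (allFin n) (λ c → ∑ (Sym n) (λ w → ⟦ does (addRook S r c ⊆? graph? w) ⟧))
      ≡⟨ ∑-comm (allFin n) (Sym n) _ ⟩
    ∑ (Sym n) (λ w → ∑ (allFin n) (λ c → ⟦ does (addRook S r c ⊆? graph? w) ⟧))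
      ≡⟨ ∑-cong (Sym n) (λ w → ∑-cong (allFin n) (split w)) ⟩
    ∑ (Sym n) (λ w → ∑ (allFin n) (λ c → ⟦ does (w r ≟F c) ⟧ * ⟦ does (S ⊆? graph? w) ⟧))
      ≡⟨ ∑-cong (Sym n) (λ w → sym (*-distribʳ-∑ _ (allFin n) λ c → ⟦ does (w r ≟F c) ⟧)) ⟩
    ∑ (Sym n) (λ w → ∑ (allFin n) (λ c → ⟦ does (w r ≟F c) ⟧) * ⟦ does (S ⊆? graph? w) ⟧)
      ≡⟨ ∑-cong (Sym n) (λ w → trans (cong (_* _) (∑-δ (w r) (λ _ → 1))) (ℕP.*-identityˡ _)) ⟩
    #extensions S ∎)
    where
    split : ∀ w c → ⟦ does (addRook S r c ⊆? graph? w) ⟧ ≡ ⟦ does (w r ≟F c) ⟧ * ⟦ does (S ⊆? graph? w) ⟧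
    split w c =
      trans (cong ⟦_⟧ (does-⇔ addRook-⊆-graph (addRook S r c ⊆? graph? w) (w r ≟F c ×-dec S ⊆? graph? w)))
            (⟦∧⟧ (does (w r ≟F c)) (does (S ⊆? graph? w)))

  #extensions-attacking : ∀ {S} → ¬ NonAttacking S → #extensions S ≡ 0
  #extensions-attacking {S} attacking =
    trans (∑-filter (isPerm? n) (allFns n (allFin n)) _)
          (trans (∑-cong (allFns n (allFin n)) (λ w → term≡0 w (isPerm? n w))) (∑-zero (allFns n (allFin n))))
    where
    term≡0 : ∀ w (perm? : Dec (IsPerm n w)) → ⟦ does perm? ⟧ * ⟦ does (S ⊆? graph? w) ⟧ ≡ 0
    term≡0 w (yes perm) = trans (ℕP.*-identityˡ _)
                                (cong ⟦_⟧ (dec-false (S ⊆? graph? w) (attacking ∘ ⊆-graph⇒nonAttacking perm)))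
    term≡0 w (no _)     = refl

  #extensions-full : ∀ {S} → NonAttacking S → (∀ r → ¬ EmptyRow S r) → #extensions S ≡ 1
  #extensions-full {S} na occupied = begin
    #extensions S
      ≡⟨ ∑-filter (isPerm? n) (allFns n (allFin n)) _ ⟩
    ∑ (allFns n (allFin n)) (λ w → ⟦ does (isPerm? n w) ⟧ * ⟦ does (S ⊆? graph? w) ⟧)
      ≡⟨ ∑-cong (allFns n (allFin n)) term ⟩
    ∑ (allFns n (allFin n)) (λ w → ∏ (allFin n) (λ r → ⟦ does (p r ≟F w r) ⟧))
      ≡⟨ ∏-distrib-∑ n (allFin n) (λ r a → ⟦ does (p r ≟F a) ⟧) ⟨
    ∏ (allFin n) (λ r → ∑ (allFin n) (λ a → ⟦ does (p r ≟F a) ⟧))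
      ≡⟨ ∏-cong (allFin n) (λ r → ∑-δ (p r) (λ _ → 1)) ⟩
    ∏ (allFin n) (λ _ → 1)
      ≡⟨ ∏-one (allFin n) ⟩
    1 ∎
    where
    p : Fin n → Fin n
    p r = proj₁ (rook-in-row S r (occupied r))
    occ : ∀ r → Occ S r (p r)
    occ r = proj₂ (rook-in-row S r (occupied r))
    extension⇔p : ∀ {w} → (IsPerm n w × S ⊆ Graph w) ⇔ (∀ r → p r ≡ w r)
    extension⇔p = mk⇔
      (λ { (_ , S⊆w) r → sym (S⊆w r (p r) (occ r)) })
      (λ p≗w → (λ i j wi≡wj → proj₂ (na i (p i) j (p j) (occ i) (occ j))
                                     (trans (p≗w i) (trans wi≡wj (sym (p≗w j)))))
             , (λ r c o → trans (sym (p≗w r)) (proj₁ (na r (p r) r c (occ r) o) refl)))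
    term : ∀ w → ⟦ does (isPerm? n w) ⟧ * ⟦ does (S ⊆? graph? w) ⟧
                 ≡ ∏ (allFin n) (λ r → ⟦ does (p r ≟F w r) ⟧)
    term w = begin
      ⟦ does (isPerm? n w) ⟧ * ⟦ does (S ⊆? graph? w) ⟧
        ≡⟨ ⟦∧⟧ (does (isPerm? n w)) (does (S ⊆? graph? w)) ⟨
      ⟦ does (isPerm? n w ×-dec S ⊆? graph? w) ⟧
        ≡⟨ cong ⟦_⟧ (does-⇔ extension⇔p (isPerm? n w ×-dec S ⊆? graph? w) (all? λ r → p r ≟F w r)) ⟩
      ⟦ does (all? λ r → p r ≟F w r) ⟧
        ≡⟨ ∏-⟦⟧ (λ r → p r ≟F w r) ⟨
      ∏ (allFin n) (λ r → ⟦ does (p r ≟F w r) ⟧) ∎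

  #extensions-fillRow : ∀ {S r m} → EmptyRow S r →
                        (∀ c → EmptyRow (flip S) c → #extensions (addRook S r c) ≡ m) →
                        #extensions S ≡ #emptyRows (flip S) * m
  #extensions-fillRow {S} {r} {m} emptyR fill = begin
    #extensions S
      ≡⟨ #extensions-addRook S r ⟩
    ∑ (allFin n) (λ c → #extensions (addRook S r c))
      ≡⟨ ∑-cong (allFin n) (λ c → column c (emptyRow? (flip S) c)) ⟩
    ∑ (allFin n) (λ c → ⟦ does (emptyRow? (flip S) c) ⟧ * m)
      ≡⟨ *-distribʳ-∑ m (allFin n) _ ⟨
    #emptyRows (flip S) * m ∎
    where
    column : ∀ c (emptyC? : Dec (EmptyRow (flip S) c)) → #extensions (addRook S r c) ≡ ⟦ does emptyC? ⟧ * m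
    column c (yes emptyC)   = trans (fill c emptyC) (sym (ℕP.*-identityˡ m))
    column c (no nonemptyC) =
      #extensions-attacking (addRook-attacking {S} {r} {c} emptyR (proj₂ (rook-in-row (flip S) c nonemptyC)))

  #extensions-nonAttacking : ∀ {S} → NonAttacking S → #extensions S ≡ (n ∸ numCells n S) !
  #extensions-nonAttacking {S} na = count (n ∸ numCells n S) na (ℕP.m+[n∸m]≡n (numCells≤n na))
    where
    -- f counts the empty rows of S, and also its empty columns.
    count : ∀ f {S} → NonAttacking S → numCells n S + f ≡ n → #extensions S ≡ f !
    count zero    na size = #extensions-full na (#emptyRows≡0⇒noEmptyRow (numCells+f≡n⇒#emptyRows≡f na size))
    count (suc f) {S} na size
      with #emptyRows≢0⇒emptyRow (ℕP.1+n≢0 ∘ trans (sym (numCells+f≡n⇒#emptyRows≡f na size)))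
    ... | r , emptyR = begin
      #extensions S
        ≡⟨ #extensions-fillRow emptyR (λ c emptyC → count f (addRook-nonAttacking na emptyR emptyC) (size′ c)) ⟩
      #emptyRows (flip S) * f !
        ≡⟨ cong (_* f !) (numCells+f≡n⇒#emptyRows≡f (nonAttacking-flip na)
                                                   (trans (cong (_+ suc f) (numCells-flip S)) size)) ⟩
      suc f * f ! ∎
      where
      size′ : ∀ c → numCells n (addRook S r c) + f ≡ n
      size′ c = trans (cong (_+ f) (numCells-addRook (emptyR c))) (trans (sym (ℕP.+-suc _ f)) size)

open Int using (_+_; _*_; _-_; _^_)
open ℤ∑
open ≡-Reasoning

+-∑ : ∀ {X : Set} (xs : List X) (f : X → ℕ) → + ℕ∑.∑ xs f ≡ ∑ xs (λ x → + f x)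
+-∑ []       f = refl
+-∑ (x ∷ xs) f = trans (ℤP.pos-+ (f x) _) (cong (_+_ (+ f x)) (+-∑ xs f))

+⟦⟧ : ∀ β → + ℕ∑.⟦ β ⟧ ≡ ⟦ β ⟧
+⟦⟧ true  = refl
+⟦⟧ false = refl

^-∑ : ∀ {X : Set} t (xs : List X) (f : X → ℕ) → t ^ ℕ∑.∑ xs f ≡ ∏ xs (λ x → t ^ f x)
^-∑ t []       f = refl
^-∑ t (x ∷ xs) f = trans (ℤP.^-distribˡ-+-* t (f x) _) (cong (t ^ f x *_) (^-∑ t xs f))

^-⟦⟧ : ∀ t β → t ^ ℕ∑.⟦ β ⟧ ≡ (if β then t else + 1)
^-⟦⟧ t true  = ℤP.*-identityʳ t
^-⟦⟧ t false = refl

^-length-filter : ∀ {X : Set} {p} {P : Pred X p} (P? : Decidable P) t xs →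
                  t ^ length (filter P? xs) ≡ ∏ xs (λ x → if does (P? x) then t else + 1)
^-length-filter P? t xs =
  trans (cong (t ^_) (length-filter≡∑⟦⟧ P? xs))
        (trans (^-∑ t xs _) (∏-cong xs (λ x → ^-⟦⟧ t (does (P? x)))))

∏-cells : ∀ {n} → CellSet n → (Fin n → Fin n → ℤ) → ℤ
∏-cells {n} S g = ∏ (allFin n) (λ r → ∏ (allFin n) (λ c → if S r c then g r c else + 1))

module _ {n : ℕ} (S : CellSet n) where

  ∏-cells-* : ∀ g h → ∏-cells S (λ r c → g r c * h r c) ≡ ∏-cells S g * ∏-cells S h
  ∏-cells-* g h =
    trans (∏-cong (allFin n) λ r → trans (∏-cong (allFin n) λ c → split (S r c)) (∏-* (allFin n) _ _))
          (∏-* (allFin n) _ _)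
    where
    split : ∀ {y z} β → (if β then y * z else + 1) ≡ (if β then y else + 1) * (if β then z else + 1)
    split true  = refl
    split false = refl

  ∏-cells-const : ∀ x → ∏-cells S (λ _ _ → x) ≡ x ^ numCells n S
  ∏-cells-const x = sym (begin
    x ^ numCells n S
      ≡⟨ cong (x ^_) (numCells≡∑∑ S) ⟩
    x ^ ℕ∑.∑ (allFin n) (λ r → ℕ∑.∑ (allFin n) (λ c → ℕ∑.⟦ S r c ⟧))
      ≡⟨ ^-∑ x (allFin n) _ ⟩
    ∏ (allFin n) (λ r → x ^ ℕ∑.∑ (allFin n) (λ c → ℕ∑.⟦ S r c ⟧))
      ≡⟨ ∏-cong (allFin n) (λ r → trans (^-∑ x (allFin n) _)
                                         (∏-cong (allFin n) (λ c → ^-⟦⟧ x (S r c)))) ⟩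
    ∏-cells S (λ _ _ → x) ∎)

  ∏-cells-⟦⟧ : ∀ {A : Fin n → Fin n → Set} (A? : ∀ r c → Dec (A r c)) →
               ∏-cells S (λ r c → ⟦ does (A? r c) ⟧) ≡ ⟦ does (S ⊆? A?) ⟧
  ∏-cells-⟦⟧ A? = begin
    ∏-cells S (λ r c → ⟦ does (A? r c) ⟧)
      ≡⟨ ∏-cong (allFin n) (λ r → ∏-cong (allFin n) (λ c → implication (S r c) (A? r c))) ⟩
    ∏ (allFin n) (λ r → ∏ (allFin n) (λ c → ⟦ does ((S r c ≟B true) →-dec A? r c) ⟧))
      ≡⟨ ∏-cong (allFin n) (λ r → ∏-⟦⟧ (λ c → (S r c ≟B true) →-dec A? r c)) ⟩
    ∏ (allFin n) (λ r → ⟦ does (all? λ c → (S r c ≟B true) →-dec A? r c) ⟧)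
      ≡⟨ ∏-⟦⟧ (λ r → all? λ c → (S r c ≟B true) →-dec A? r c) ⟩
    ⟦ does (S ⊆? A?) ⟧ ∎
    where
    implication : ∀ β {B : Set} (B? : Dec B) →
                  (if β then ⟦ does B? ⟧ else + 1) ≡ ⟦ does ((β ≟B true) →-dec B?) ⟧
    implication true  B? = refl
    implication false B? = refl

inBoard? : ∀ {n} (b : Vec ℕ n) r c → Dec (InBoard b r c)
inBoard? b r c = suc (toℕ r) <? lookup b c

1+[t-1]≡t : ∀ t → + 1 + (t - + 1) ≡ t
1+[t-1]≡t t = trans (ℤP.+-comm (+ 1) (t - + 1)) (trans (ℤP.+-assoc t _ (+ 1)) (ℤP.+-identityʳ t))

module _ {n : ℕ} (b : Vec ℕ n) where

  row-expansion : ∀ {t x} → + 1 + x ≡ t → ∀ w r →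
                  ∏ (allFin n) (λ c → + 1 + x * ⟦ does (graph? w r c ×-dec inBoard? b r c) ⟧)
                  ≡ (if does (inBoard? b r (w r)) then t else + 1)
  row-expansion {t} {x} 1+x≡t w r = begin
    ∏ (allFin n) (λ c → + 1 + x * ⟦ does (graph? w r c ×-dec inBoard? b r c) ⟧)
      ≡⟨ ∏-cong (allFin n) (λ c → on-row c (graph? w r c)) ⟩
    ∏ (allFin n) (λ c → if does (w r ≟F c) then + 1 + x * ⟦ does (inBoard? b r c) ⟧ else + 1)
      ≡⟨ ∏-δ (w r) (λ c → + 1 + x * ⟦ does (inBoard? b r c) ⟧) ⟩
    + 1 + x * ⟦ does (inBoard? b r (w r)) ⟧
      ≡⟨ 1+x⟦⟧ (does (inBoard? b r (w r))) ⟩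
    (if does (inBoard? b r (w r)) then t else + 1) ∎
    where
    1+x⟦⟧ : ∀ β → + 1 + x * ⟦ β ⟧ ≡ (if β then t else + 1)
    1+x⟦⟧ true  = trans (cong (_+_ (+ 1)) (ℤP.*-identityʳ x)) 1+x≡t
    1+x⟦⟧ false = cong (_+_ (+ 1)) (ℤP.*-zeroʳ x)
    on-row : ∀ c (w[r]≟c : Dec (w r ≡ c)) →
             + 1 + x * ⟦ does (w[r]≟c ×-dec inBoard? b r c) ⟧
             ≡ (if does w[r]≟c then + 1 + x * ⟦ does (inBoard? b r c) ⟧ else + 1)
    on-row c (yes _) = refl
    on-row c (no _)  = 1+x⟦⟧ false

  t^exced-expansion : ∀ {t x} → + 1 + x ≡ t → ∀ w →
                      t ^ exced n (πbw b w)
                      ≡ ∑ (allCellSets n) (λ S → x ^ numCells n S *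
                                                  (⟦ does (S ⊆? graph? w) ⟧ * ⟦ does (S ⊆? inBoard? b) ⟧))
  t^exced-expansion {t} {x} 1+x≡t w = begin
    t ^ exced n (πbw b w)
      ≡⟨ ^-length-filter (λ r → inBoard? b r (w r)) t (allFin n) ⟩
    ∏ (allFin n) (λ r → if does (inBoard? b r (w r)) then t else + 1)
      ≡⟨ ∏-cong (allFin n) (row-expansion {t} {x} 1+x≡t w) ⟨
    ∏ (allFin n) (λ r → ∏ (allFin n) (λ c → + 1 + x * ⟦ does (cell? r c) ⟧))
      ≡⟨ ∏∏-1+ n n (λ r c → x * ⟦ does (cell? r c) ⟧) ⟩
    ∑ (allCellSets n) (λ S → ∏-cells S (λ r c → x * ⟦ does (cell? r c) ⟧))
      ≡⟨ ∑-cong (allCellSets n) (λ S → trans (∏-cells-* S (λ _ _ → x) _)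
                                             (cong₂ _*_ (∏-cells-const S x) (∏-cells-⟦⟧ S cell?))) ⟩
    ∑ (allCellSets n) (λ S → x ^ numCells n S * ⟦ does (S ⊆? cell?) ⟧)
      ≡⟨ ∑-cong (allCellSets n) (λ S → cong (x ^ numCells n S *_) (⊆?-× S)) ⟩
    ∑ (allCellSets n) (λ S → x ^ numCells n S * (⟦ does (S ⊆? graph? w) ⟧ * ⟦ does (S ⊆? inBoard? b) ⟧)) ∎
    where
    cell? : ∀ r c → Dec (w r ≡ c × InBoard b r c)
    cell? r c = graph? w r c ×-dec inBoard? b r c
    ⊆?-× : ∀ S → ⟦ does (S ⊆? cell?) ⟧ ≡ ⟦ does (S ⊆? graph? w) ⟧ * ⟦ does (S ⊆? inBoard? b) ⟧
    ⊆?-× S = trans (cong ⟦_⟧ (does-⇔ ⊆-×-⇔ (S ⊆? cell?) (S ⊆? graph? w ×-dec S ⊆? inBoard? b)))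
                   (⟦∧⟧ (does (S ⊆? graph? w)) (does (S ⊆? inBoard? b)))
  lhs-expansion : ∀ {t x} → + 1 + x ≡ t →
                  lhs n b t ≡ ∑ (allCellSets n) (λ S → x ^ numCells n S *
                                                      (+ #extensions S * ⟦ does (S ⊆? inBoard? b) ⟧))
  lhs-expansion {t} {x} 1+x≡t = begin
    lhs n b t
      ≡⟨ ∑-cong (Sym n) (t^exced-expansion {t} {x} 1+x≡t) ⟩
    ∑ (Sym n) (λ w → ∑ (allCellSets n) (term w))
      ≡⟨ ∑-comm (Sym n) (allCellSets n) term ⟩
    ∑ (allCellSets n) (λ S → ∑ (Sym n) (λ w → term w S))
      ≡⟨ ∑-cong (allCellSets n) extensions ⟩
    ∑ (allCellSets n) (λ S → x ^ numCells n S * (+ #extensions S * ⟦ does (S ⊆? inBoard? b) ⟧)) ∎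
    where
    term : (Fin n → Fin n) → CellSet n → ℤ
    term w S = x ^ numCells n S * (⟦ does (S ⊆? graph? w) ⟧ * ⟦ does (S ⊆? inBoard? b) ⟧)
    extensions : ∀ S → ∑ (Sym n) (λ w → term w S)
                       ≡ x ^ numCells n S * (+ #extensions S * ⟦ does (S ⊆? inBoard? b) ⟧)
    extensions S = begin
      ∑ (Sym n) (λ w → term w S)
        ≡⟨ *-distribˡ-∑ (x ^ numCells n S) (Sym n) _ ⟨
      x ^ numCells n S * ∑ (Sym n) (λ w → ⟦ does (S ⊆? graph? w) ⟧ * ⟦ does (S ⊆? inBoard? b) ⟧)
        ≡⟨ cong (x ^ numCells n S *_) (*-distribʳ-∑ ⟦ does (S ⊆? inBoard? b) ⟧ (Sym n) _) ⟨
      x ^ numCells n S * (∑ (Sym n) (λ w → ⟦ does (S ⊆? graph? w) ⟧) * ⟦ does (S ⊆? inBoard? b) ⟧)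
        ≡⟨ cong (λ e → x ^ numCells n S * (e * ⟦ does (S ⊆? inBoard? b) ⟧)) #extensions-as-ℤ ⟨
      x ^ numCells n S * (+ #extensions S * ⟦ does (S ⊆? inBoard? b) ⟧) ∎
      where
      #extensions-as-ℤ : + #extensions S ≡ ∑ (Sym n) (λ w → ⟦ does (S ⊆? graph? w) ⟧)
      #extensions-as-ℤ = trans (+-∑ (Sym n) _) (∑-cong (Sym n) (λ w → +⟦⟧ _))

  extensions-on-board : ∀ S (sub? : Dec (S ⊆ InBoard b)) (na? : Dec (NonAttackingOn n b S)) →
                        + #extensions S * ⟦ does sub? ⟧ ≡ + ((n ∸ numCells n S) !) * ⟦ does na? ⟧
  extensions-on-board S sub?      (yes (sub , na)) =
    cong₂ _*_ (cong +_ (#extensions-nonAttacking na)) (cong ⟦_⟧ (dec-true sub? sub))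
  extensions-on-board S (yes sub) (no ¬na) = begin
    + #extensions S * + 1              ≡⟨ cong (λ k → + k * + 1) (#extensions-attacking (¬na ∘ (sub ,_))) ⟩
    + 0                                ≡⟨ ℤP.*-zeroʳ (+ ((n ∸ numCells n S) !)) ⟨
    + ((n ∸ numCells n S) !) * + 0     ∎
  extensions-on-board S (no _)    (no _)   = begin
    + #extensions S * + 0              ≡⟨ ℤP.*-zeroʳ (+ #extensions S) ⟩
    + 0                                ≡⟨ ℤP.*-zeroʳ (+ ((n ∸ numCells n S) !)) ⟨
    + ((n ∸ numCells n S) !) * + 0     ∎

  rhs-expansion : ∀ t → rhs n b t ≡ ∑ (allCellSets n) (λ S → (t - + 1) ^ numCells n S *
                                       (+ ((n ∸ numCells n S) !) * ⟦ does (nonAttackingOn? n b S) ⟧))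
  rhs-expansion t = begin
    rhs n b t
      ≡⟨ ∑-cong (upTo (suc n)) (λ k → cong (λ z → z * F k * x ^ k) (rook≡∑ k)) ⟩
    ∑ (upTo (suc n)) (λ k → ∑ (allCellSets n) (λ S → ⟦ does (rook? S k) ⟧) * F k * x ^ k)
      ≡⟨ ∑-cong (upTo (suc n)) (λ k → trans (cong (_* x ^ k) (*-distribʳ-∑ (F k) (allCellSets n) _))
                                            (*-distribʳ-∑ (x ^ k) (allCellSets n) _)) ⟩
    ∑ (upTo (suc n)) (λ k → ∑ (allCellSets n) (λ S → ⟦ does (rook? S k) ⟧ * F k * x ^ k))
      ≡⟨ ∑-comm (upTo (suc n)) (allCellSets n) _ ⟩
    ∑ (allCellSets n) (λ S → ∑ (upTo (suc n)) (λ k → ⟦ does (rook? S k) ⟧ * F k * x ^ k))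
      ≡⟨ ∑-cong (allCellSets n) (λ S → sizes S (nonAttackingOn? n b S)) ⟩
    ∑ (allCellSets n) (λ S → x ^ numCells n S * (F (numCells n S) * ⟦ does (nonAttackingOn? n b S) ⟧)) ∎
    where
    x : ℤ
    x = t - + 1
    F : ℕ → ℤ
    F k = + ((n ∸ k) !)
    rook? : ∀ S k → Dec (NonAttackingOn n b S × numCells n S ≡ k)
    rook? S k = nonAttackingOn? n b S ×-dec numCells n S ≟ℕ k
    rook≡∑ : ∀ k → + rook n b k ≡ ∑ (allCellSets n) (λ S → ⟦ does (rook? S k) ⟧)
    rook≡∑ k = trans (cong +_ (length-filter≡∑⟦⟧ (λ S → rook? S k) (allCellSets n)))
                     (trans (+-∑ (allCellSets n) _) (∑-cong (allCellSets n) (λ S → +⟦⟧ _)))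
    sizes : ∀ S (na? : Dec (NonAttackingOn n b S)) →
            ∑ (upTo (suc n)) (λ k → ⟦ does (na? ×-dec numCells n S ≟ℕ k) ⟧ * F k * x ^ k)
            ≡ x ^ numCells n S * (F (numCells n S) * ⟦ does na? ⟧)
    sizes S (yes (_ , na)) = begin
      ∑ (upTo (suc n)) (λ k → ⟦ does (numCells n S ≟ℕ k) ⟧ * F k * x ^ k)
        ≡⟨ ∑-cong (upTo (suc n)) (λ k → ℤP.*-assoc ⟦ does (numCells n S ≟ℕ k) ⟧ (F k) (x ^ k)) ⟩
      ∑ (upTo (suc n)) (λ k → ⟦ does (numCells n S ≟ℕ k) ⟧ * (F k * x ^ k))
        ≡⟨ ∑-upTo-δ (numCells≤n na) (λ k → F k * x ^ k) ⟩
      F (numCells n S) * x ^ numCells n S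
        ≡⟨ ℤP.*-comm (F (numCells n S)) (x ^ numCells n S) ⟩
      x ^ numCells n S * F (numCells n S)
        ≡⟨ cong (x ^ numCells n S *_) (ℤP.*-identityʳ (F (numCells n S))) ⟨
      x ^ numCells n S * (F (numCells n S) * + 1) ∎
    sizes S (no _) = begin
      ∑ (upTo (suc n)) (λ _ → + 0)                  ≡⟨ ∑-zero (upTo (suc n)) ⟩
      + 0                                           ≡⟨ ℤP.*-zeroʳ (x ^ numCells n S) ⟨
      x ^ numCells n S * + 0                        ≡⟨ cong (x ^ numCells n S *_) (ℤP.*-zeroʳ (F (numCells n S))) ⟨
      x ^ numCells n S * (F (numCells n S) * + 0)   ∎

lemma3p3 : (n : ℕ) → 1 ≤ n → (b : Vec ℕ n) → IsParkingContent n b →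
           (t : ℤ) → lhs n b t ≡ rhs n b t
lemma3p3 n _ b _ t = begin
  lhs n b t
    ≡⟨ lhs-expansion b {t} (1+[t-1]≡t t) ⟩
  ∑ (allCellSets n) (λ S → (t - + 1) ^ numCells n S * (+ #extensions S * ⟦ does (S ⊆? inBoard? b) ⟧))
    ≡⟨ ∑-cong (allCellSets n) (λ S → cong ((t - + 1) ^ numCells n S *_)
                                           (extensions-on-board b S (S ⊆? inBoard? b) (nonAttackingOn? n b S))) ⟩
  ∑ (allCellSets n) (λ S → (t - + 1) ^ numCells n S * (+ ((n ∸ numCells n S) !) * ⟦ does (nonAttackingOn? n b S) ⟧))
    ≡⟨ rhs-expansion b t ⟨
  rhs n b t ∎
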